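{- Let $n\ge 1$ and let $w=w_1\cdots w_n$ and $z=z_1\cdots z_n$ be two words of length $n$ that differ in exactly one position. Then the binary strings $\beta(w)$ and $\beta(z)$ (defined in the context) differ in exactly two bits.
   Context: A word of length $n$ is a sequence $w_1w_2\cdots w_n$ of integers with $w_1=2$ and $w_{m+1}\in\{2,3,\dots,w_m+1\}$ for $1\le m<n$ (these encode, via the Catalan succession rule $(2)$, $(k)\rightsquigarrow(2)(3)\cdots(k+1)$, the ECO construction of Dyck paths in which a path whose last descent has $k-1$ down steps has $k$ active sites, and a new peak is inserted in an active site of the last descent). To each word associate a binary string of length $2n$ (the Dyck path with up steps written as $1$ and down steps as $0$) recursively: $\beta(2)=10$; if $u=\beta(w_1\cdots w_{n-1})$, then $u$ ends with exactly $w_{n-1}-1$ zeros, and $\beta(w_1\cdots w_n)$ is obtained from $u$ by replacing these final $w_{n-1}-1$ zeros by the block $0^{\,w_{n-1}-w_n+1}\,1\,0^{\,w_n-1}$ (here $0^r$ denotes $r$ consecutive zeros). For example $\beta(2)=10$, $\beta(23)=1100$, $\beta(233)=110100$, $\beta(2334)=11011000$. -}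

module Defs where

open import Data.Nat using (ℕ; zero; suc; _+_; _∸_; _≤_)
open import Data.Bool using (Bool; true; false)
open import Data.List using (List; []; _∷_; _++_; replicate; take; length)
open import Data.Product using (_×_)
open import Data.Empty using (⊥)
open import Relation.Binary.PropositionalEquality using (_≡_)
open import Relation.Binary using (DecidableEquality)
open import Relation.Nullary using (yes; no)

-- Follows p ws : the list ws continues a word whose last letter is p,
-- i.e. each next letter q satisfies 2 ≤ q ≤ (previous letter) + 1.
data Follows : ℕ → List ℕ → Set where
  []  : ∀ {p} → Follows p []
  _∷_ : ∀ {p q ws} → (2 ≤ q) × (q ≤ suc p) → Follows q ws → Follows p (q ∷ ws)

IsWord : List ℕ → Set
IsWord []       = ⊥
IsWord (w ∷ ws) = (w ≡ 2) × Follows w ws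

-- One step of the recursion: u ends with p-1 zeros (p = previous letter);
-- replace these final p-1 zeros by 0^(p-q+1) 1 0^(q-1).
step : List Bool → ℕ → ℕ → List Bool
step u p q =
  take (length u ∸ (p ∸ 1)) u
    ++ replicate (suc p ∸ q) false ++ (true ∷ replicate (q ∸ 1) false)

go : List Bool → ℕ → List ℕ → List Bool
go u p []       = u
go u p (q ∷ ws) = go (step u p q) q ws

-- β : word ↦ binary string (1 = up step, 0 = down step).
-- β(w₁) = 1 0^(w₁-1), which is 10 for w₁ = 2.
β : List ℕ → List Bool
β []       = []
β (w ∷ ws) = go (true ∷ replicate (w ∸ 1) false) w ws

-- Number of positions at which two lists differ (Hamming distance;
-- only used on lists of equal length).
diffCount : {A : Set} → DecidableEquality A → List A → List A → ℕ
diffCount _≟_ (x ∷ xs) (y ∷ ys) with x ≟ y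
... | yes _ = diffCount _≟_ xs ys
... | no  _ = suc (diffCount _≟_ xs ys)
diffCount _≟_ _ _ = 0

-- After its leading 1, β(w) is the concatenation, over the letters w_{m+1}, of the blocks
-- 0^(w_m+1-w_{m+1}) 1, followed by 0^(w_n-1). Changing a single letter w_{m+1} therefore only
-- moves one 1 inside the window of zeros around it: the zeros in front of it and those behind it
-- (up to the next 1, or to the end) add up to a total that does not depend on w_{m+1}. Moving a
-- single 1 inside a window of zeros flips exactly two bits.
module Submission where

open import Defs
open import Data.Nat using (ℕ; zero; suc; _+_; _∸_; _≤_; s≤s)
open import Data.Nat.Properties
  using (suc-injective; +-suc; +-∸-assoc; m∸n+n≡m; m+n∸n≡m; ∸-cancelˡ-≡)
  renaming (_≟_ to _≟ℕ_)
open import Data.Bool using (Bool; true; false)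
open import Data.Bool.Properties using () renaming (_≟_ to _≟𝔹_)
open import Data.Vec using (Vec; toList; []; _∷_)
open import Data.List using (List; []; _∷_; _++_; replicate; take; length)
open import Data.List.Properties using (++-assoc; ++-identityʳ; length-++; length-replicate)
open import Data.Product using (_,_)
open import Data.Empty using (⊥-elim)
open import Relation.Binary using (DecidableEquality)
open import Relation.Nullary using (yes; no)
open import Relation.Binary.PropositionalEquality

private
  variable
    A : Set

module _ (_≟_ : DecidableEquality A) where

  diffCount-refl : (xs : List A) → diffCount _≟_ xs xs ≡ 0
  diffCount-refl []       = refl
  diffCount-refl (x ∷ xs) with x ≟ x
  ... | yes _  = diffCount-refl xs
  ... | no x≢x = ⊥-elim (x≢x refl)

  diffCount-sym : (xs ys : List A) → diffCount _≟_ xs ys ≡ diffCount _≟_ ys xs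
  diffCount-sym []       []       = refl
  diffCount-sym []       (_ ∷ _)  = refl
  diffCount-sym (_ ∷ _)  []       = refl
  diffCount-sym (x ∷ xs) (y ∷ ys) with x ≟ y | y ≟ x
  ... | yes _   | yes _   = diffCount-sym xs ys
  ... | no _    | no _    = cong suc (diffCount-sym xs ys)
  ... | yes x≡y | no y≢x  = ⊥-elim (y≢x (sym x≡y))
  ... | no x≢y  | yes y≡x = ⊥-elim (x≢y (sym y≡x))

  diffCount-++ˡ : (xs ys zs : List A) → diffCount _≟_ (xs ++ ys) (xs ++ zs) ≡ diffCount _≟_ ys zs
  diffCount-++ˡ []       ys zs = refl
  diffCount-++ˡ (x ∷ xs) ys zs with x ≟ x
  ... | yes _  = diffCount-++ˡ xs ys zs
  ... | no x≢x = ⊥-elim (x≢x refl)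

  diffCount≡0⇒≡ : ∀ {n} (xs ys : Vec A n) → diffCount _≟_ (toList xs) (toList ys) ≡ 0 → xs ≡ ys
  diffCount≡0⇒≡ []       []       _ = refl
  diffCount≡0⇒≡ (x ∷ xs) (y ∷ ys) h with x ≟ y
  diffCount≡0⇒≡ (x ∷ xs) (y ∷ ys) h  | yes x≡y = cong₂ _∷_ x≡y (diffCount≡0⇒≡ xs ys h)
  diffCount≡0⇒≡ (x ∷ xs) (y ∷ ys) () | no _

zeros : ℕ → List Bool
zeros k = replicate k false

diffCount-zeros-one : (c d : ℕ) (R : List Bool) →
  diffCount _≟𝔹_ (zeros (c + suc d) ++ R) (zeros c ++ true ∷ zeros d ++ R) ≡ 1
diffCount-zeros-one zero    d R = cong suc (diffCount-refl _≟𝔹_ (zeros d ++ R))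
diffCount-zeros-one (suc c) d R = diffCount-zeros-one c d R

diffCount-move-one : (a b c d : ℕ) (R : List Bool) → a + b ≡ c + d → a ≢ c →
  diffCount _≟𝔹_ (zeros a ++ true ∷ zeros b ++ R) (zeros c ++ true ∷ zeros d ++ R) ≡ 2
diffCount-move-one zero b zero d R _ a≢c = ⊥-elim (a≢c refl)
diffCount-move-one zero b (suc c) d R b≡c+1+d _ =
  cong suc (subst (λ k → diffCount _≟𝔹_ (zeros k ++ R) _ ≡ 1)
                  (trans (+-suc c d) (sym b≡c+1+d)) (diffCount-zeros-one c d R))
diffCount-move-one (suc a) b zero d R a+1+b≡d _ =
  cong suc (trans (diffCount-sym _≟𝔹_ (zeros a ++ true ∷ zeros b ++ R) (zeros d ++ R))
                  (subst (λ k → diffCount _≟𝔹_ (zeros k ++ R) (zeros a ++ true ∷ zeros b ++ R) ≡ 1)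
                         (trans (+-suc a b) a+1+b≡d) (diffCount-zeros-one a b R)))
diffCount-move-one (suc a) b (suc c) d R eq a≢c =
  diffCount-move-one a b c d R (suc-injective eq) (λ a≡c → a≢c (cong suc a≡c))

descents : ℕ → List ℕ → List Bool
descents p []       = zeros (p ∸ 1)
descents p (q ∷ ws) = zeros (suc p ∸ q) ++ true ∷ descents q ws

take-length-++ : (xs ys : List A) → take (length xs) (xs ++ ys) ≡ xs
take-length-++ []       ys = refl
take-length-++ (x ∷ xs) ys = cong (x ∷_) (take-length-++ xs ys)

step-++-zeros : (X : List Bool) (p q : ℕ) →
  step (X ++ zeros (p ∸ 1)) p q ≡ (X ++ zeros (suc p ∸ q) ++ true ∷ []) ++ zeros (q ∸ 1)
step-++-zeros X p q = begin
    take (length (X ++ zeros (p ∸ 1)) ∸ (p ∸ 1)) (X ++ zeros (p ∸ 1)) ++ block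
  ≡⟨ cong (λ k → take k (X ++ zeros (p ∸ 1)) ++ block) prefix-length ⟩
    take (length X) (X ++ zeros (p ∸ 1)) ++ block
  ≡⟨ cong (_++ block) (take-length-++ X (zeros (p ∸ 1))) ⟩
    X ++ block
  ≡⟨ cong (X ++_) (sym (++-assoc (zeros (suc p ∸ q)) (true ∷ []) (zeros (q ∸ 1)))) ⟩
    X ++ (zeros (suc p ∸ q) ++ true ∷ []) ++ zeros (q ∸ 1)
  ≡⟨ sym (++-assoc X _ _) ⟩
    (X ++ zeros (suc p ∸ q) ++ true ∷ []) ++ zeros (q ∸ 1)
  ∎
  where
  open ≡-Reasoning
  block = zeros (suc p ∸ q) ++ true ∷ zeros (q ∸ 1)
  prefix-length : length (X ++ zeros (p ∸ 1)) ∸ (p ∸ 1) ≡ length X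
  prefix-length rewrite length-++ X {zeros (p ∸ 1)} | length-replicate (p ∸ 1) {false} =
    m+n∸n≡m (length X) (p ∸ 1)

go-++-zeros : (X : List Bool) (p : ℕ) (ws : List ℕ) → go (X ++ zeros (p ∸ 1)) p ws ≡ X ++ descents p ws
go-++-zeros X p []       = refl
go-++-zeros X p (q ∷ ws) = begin
    go (step (X ++ zeros (p ∸ 1)) p q) q ws
  ≡⟨ cong (λ u → go u q ws) (step-++-zeros X p q) ⟩
    go ((X ++ zeros (suc p ∸ q) ++ true ∷ []) ++ zeros (q ∸ 1)) q ws
  ≡⟨ go-++-zeros _ q ws ⟩
    (X ++ zeros (suc p ∸ q) ++ true ∷ []) ++ descents q ws
  ≡⟨ ++-assoc X _ _ ⟩
    X ++ (zeros (suc p ∸ q) ++ true ∷ []) ++ descents q ws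
  ≡⟨ cong (X ++_) (++-assoc (zeros (suc p ∸ q)) _ _) ⟩
    X ++ descents p (q ∷ ws)
  ∎
  where open ≡-Reasoning

β-word : (ws : List ℕ) → β (2 ∷ ws) ≡ true ∷ descents 2 ws
β-word = go-++-zeros (true ∷ []) 2

leadingZeros : ℕ → List ℕ → ℕ
leadingZeros q []      = q ∸ 1
leadingZeros q (r ∷ _) = suc q ∸ r

afterLeadingZeros : ℕ → List ℕ → List Bool
afterLeadingZeros q []       = []
afterLeadingZeros q (r ∷ ws) = true ∷ descents r ws

descents-leadingZeros : (q : ℕ) (ws : List ℕ) →
  descents q ws ≡ zeros (leadingZeros q ws) ++ afterLeadingZeros q ws
descents-leadingZeros q []      = sym (++-identityʳ (zeros (q ∸ 1)))
descents-leadingZeros q (_ ∷ _) = refl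

window-length : (p q : ℕ) (ws : List ℕ) → 2 ≤ q → q ≤ suc p → Follows q ws →
  (suc p ∸ q) + leadingZeros q ws ≡ leadingZeros (suc p) ws
window-length p (suc q) []      _ (s≤s q≤p) _               = m∸n+n≡m q≤p
window-length p q       (r ∷ _) _ q≤1+p     ((_ , r≤1+q) ∷ _) = begin
    (suc p ∸ q) + (suc q ∸ r)   ≡⟨ +-∸-assoc (suc p ∸ q) r≤1+q ⟨
    (suc p ∸ q) + suc q ∸ r     ≡⟨ cong (_∸ r) (trans (+-suc (suc p ∸ q) q) (cong suc (m∸n+n≡m q≤1+p))) ⟩
    suc (suc p) ∸ r             ∎
  where open ≡-Reasoning

descents-change-head : (p q r : ℕ) (ws : List ℕ) → q ≢ r →
  2 ≤ q → q ≤ suc p → Follows q ws → 2 ≤ r → r ≤ suc p → Follows r ws →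
  diffCount _≟𝔹_ (descents p (q ∷ ws)) (descents p (r ∷ ws)) ≡ 2
descents-change-head p q r ws q≢r 2≤q q≤1+p q-ws 2≤r r≤1+p r-ws
  rewrite descents-leadingZeros q ws | descents-leadingZeros r ws =
  diffCount-move-one (suc p ∸ q) (leadingZeros q ws) (suc p ∸ r) (leadingZeros r ws) _
    (trans (window-length p q ws 2≤q q≤1+p q-ws) (sym (window-length p r ws 2≤r r≤1+p r-ws)))
    (λ eq → q≢r (∸-cancelˡ-≡ q≤1+p r≤1+p eq))

descents-diffCount : ∀ {n} (p : ℕ) (ws zs : Vec ℕ n) → Follows p (toList ws) → Follows p (toList zs) →
  diffCount _≟ℕ_ (toList ws) (toList zs) ≡ 1 →
  diffCount _≟𝔹_ (descents p (toList ws)) (descents p (toList zs)) ≡ 2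
descents-diffCount p (q ∷ ws) (r ∷ zs) p-qws p-rzs h with q ≟ℕ r
descents-diffCount p (q ∷ ws) (.q ∷ zs) (_ ∷ q-ws) (_ ∷ q-zs) h | yes refl =
  trans (diffCount-++ˡ _≟𝔹_ (zeros (suc p ∸ q)) _ _) (descents-diffCount q ws zs q-ws q-zs h)
descents-diffCount p (q ∷ ws) (r ∷ zs) ((2≤q , q≤1+p) ∷ q-ws) ((2≤r , r≤1+p) ∷ r-zs) h | no q≢r
  with diffCount≡0⇒≡ _≟ℕ_ ws zs (suc-injective h)
... | refl = descents-change-head p q r (toList ws) q≢r 2≤q q≤1+p q-ws 2≤r r≤1+p r-zs

proposition1 : (n : ℕ) → 1 ≤ n → (w z : Vec ℕ n)
    → IsWord (toList w) → IsWord (toList z)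
    → diffCount _≟ℕ_ (toList w) (toList z) ≡ 1
    → diffCount _≟𝔹_ (β (toList w)) (β (toList z)) ≡ 2
proposition1 (suc n) _ (.2 ∷ ws) (.2 ∷ zs) (refl , ws-follows) (refl , zs-follows) h
  rewrite β-word (toList ws) | β-word (toList zs) =
  descents-diffCount 2 ws zs ws-follows zs-follows h
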